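{- Let $X\in\{0,1\}^\omega$ be $\mathrm{BP}$ random and let $g:\mathbb N\to\mathbb N$ be a primitive recursive increasing function. Then the sequence $(X(g(0)),X(g(1)),X(g(2)),\ldots)$ is also $\mathrm{BP}$ random.
   Context: For a finite string $\sigma$, $[\sigma]$ is the set of reals extending $\sigma$, and $[G]=\bigcup_{\sigma\in G}[\sigma]$. $\mu$ is the uniform measure on $\{0,1\}^\omega$. A primitive recursive test is a sequence of clopen sets $U_n=[G_n]$, where the finite sets $G_n$ of strings are given by a primitive recursive function ($g(n)$ codes $G_n$), and $\mu(U_n)\le 2^{ -n}$. A real is $\mathrm{BP}$ random if for every primitive recursive test there is $n$ with the real not in $U_n$. -}

module Defs where

open import Data.Bool using (Bool; true; false; if_then_else_)
open import Data.Nat using (ℕ; zero; suc; _+_; _*_; _^_; _≤_; _<_; _⊔_; _≡ᵇ_; _≤ᵇ_)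
open import Data.Nat.DivMod using (_/_; _%_)
open import Data.List using (List; []; _∷_; _++_; [_]; map; length; filter; foldr; concatMap; upTo; take)
open import Data.Bool.ListAction using (any)
open import Data.Vec using (Vec; []; _∷_; lookup; map)
open import Data.Fin using (Fin)
open import Data.Product using (Σ; ∃; _×_; _,_)
open import Relation.Binary.PropositionalEquality using (_≡_)
open import Relation.Nullary using (¬_)

Real : Set
Real = ℕ → Bool

Str : Set
Str = List Bool

_↾_ : Real → ℕ → Str
X ↾ zero    = []
X ↾ suc k   = X zero ∷ ((λ i → X (suc i)) ↾ k)

_∈[_] : Real → Str → Set
X ∈[ σ ] = X ↾ length σ ≡ σ

data _∈⟦_⟧ (X : Real) : List Str → Set where
  here  : ∀ {σ G} → X ∈[ σ ] → X ∈⟦ σ ∷ G ⟧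
  there : ∀ {σ G} → X ∈⟦ G ⟧ → X ∈⟦ σ ∷ G ⟧

-- Uniform measure of a clopen set [G], computed exactly:
-- with L ≥ the length of every string in G,
-- μ([G]) = #{τ ∈ {0,1}^L : τ extends some σ ∈ G} / 2^L.

allStrings : ℕ → List Str
allStrings zero    = [] ∷ []
allStrings (suc L) = concatMap (λ τ → (false ∷ τ) ∷ (true ∷ τ) ∷ []) (allStrings L)

_==ᵇ_ : Bool → Bool → Bool
true  ==ᵇ true  = true
false ==ᵇ false = true
_     ==ᵇ _     = false

isPrefix : Str → Str → Bool
isPrefix []      _       = true
isPrefix (_ ∷ _) []      = false
isPrefix (a ∷ σ) (b ∷ τ) = if a ==ᵇ b then isPrefix σ τ else false

maxLen : List Str → ℕ
maxLen = foldr (λ σ m → length σ ⊔ m) 0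

countIn : List Str → ℕ
countIn G = length (filter (λ τ → Data.Bool._≟_ (any (λ σ → isPrefix σ τ) G) true) (allStrings (maxLen G)))
  where import Data.Bool

μ[_]≤2^-_ : List Str → ℕ → Set
μ[ G ]≤2^- n = countIn G * 2 ^ n ≤ 2 ^ maxLen G

-- Strings are numbered canonically: string number i is the binary
-- expansion of i+1 with its leading 1 removed (ε, 0, 1, 00, 01, ...).
-- A number m codes the finite set {str i : bit i of m is 1}.

-- binary digits of m (m ≥ 1) without the leading 1; f is fuel ≥ m
strAux : ℕ → ℕ → Str
strAux zero    m = []
strAux (suc f) m = if m ≤ᵇ 1 then [] else (strAux f (m / 2) ++ [ m % 2 ≡ᵇ 1 ])

str : ℕ → Str
str i = strAux (suc i) (suc i)

bit : ℕ → ℕ → Bool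
bit m zero    = m % 2 ≡ᵇ 1
bit m (suc i) = bit (m / 2) i

decodeSet : ℕ → List Str
decodeSet m = Data.List.map str (filter (λ i → Data.Bool._≟_ (bit m i) true) (upTo m))
  where import Data.Bool
        import Data.List

data PR : ℕ → Set where
  Z    : PR 0
  S    : PR 1
  P    : ∀ {k} → Fin k → PR k
  C    : ∀ {k m} → PR m → Vec (PR k) m → PR k
  R    : ∀ {k} → PR k → PR (suc (suc k)) → PR (suc k)

mutual
  ⟦_⟧ : ∀ {k} → PR k → Vec ℕ k → ℕ
  ⟦ Z ⟧     _            = 0
  ⟦ S ⟧     (x ∷ [])     = suc x
  ⟦ P i ⟧   xs           = lookup xs i
  ⟦ C f gs ⟧ xs          = ⟦ f ⟧ (⟦ gs ⟧* xs)
  ⟦ R f h ⟧ (zero ∷ xs)  = ⟦ f ⟧ xs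
  ⟦ R f h ⟧ (suc n ∷ xs) = ⟦ h ⟧ (n ∷ ⟦ R f h ⟧ (n ∷ xs) ∷ xs)

  ⟦_⟧* : ∀ {k m} → Vec (PR k) m → Vec ℕ k → Vec ℕ m
  ⟦ [] ⟧*     xs = []
  ⟦ g ∷ gs ⟧* xs = ⟦ g ⟧ xs ∷ ⟦ gs ⟧* xs

PrimRec : (ℕ → ℕ) → Set
PrimRec g = Σ (PR 1) λ p → ∀ n → ⟦ p ⟧ (n ∷ []) ≡ g n

record PRTest : Set where
  field
    code    : ℕ → ℕ
    codePR  : PrimRec code
    small   : ∀ n → μ[ decodeSet (code n) ]≤2^- n

BPRandom : Real → Set
BPRandom X = (T : PRTest) → ∃ λ n → ¬ (X ∈⟦ decodeSet (PRTest.code T n) ⟧)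

StrictlyIncreasing : (ℕ → ℕ) → Set
StrictlyIncreasing g = ∀ n → g n < g (suc n)

-- Let (U n) be a primitive recursive test, G the set coded at n, c its code and N = g c.
-- Strings coded by c have length < c and g maps [0, c) into [0, N), so whether X ∘ g ∈ [G]
-- depends only on X ↾ N: it holds iff X ∈ [H], where H is the set of strings τ of length N
-- with τ ∘ g ∈ [G]. Since g is strictly increasing, X ↦ X ∘ g preserves the uniform measure,
-- so μ [H] ≤ μ [G] ≤ 2^-n. A code of H is obtained from c by bounded quantification over
-- binary digits, hence primitive recursively in n; so the sets H form a primitive recursive
-- test, X avoids one of them, and then X ∘ g avoids the corresponding U n.
module Submission where

open import Data.Bool.Base using (Bool; true; false; T; _∧_; _∨_)
open import Data.Bool.ListAction using (any; all)
open import Data.Bool.Properties using (T-≡; T-∧; _≟_)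
open import Data.Empty using (⊥-elim)
open import Data.Fin using (Fin; #_)
import Data.Fin.Base as Fin
open import Data.List.Base
  using (List; []; _∷_; [_]; _++_; length; filter; concatMap; downFrom; upTo)
open import Data.List.Membership.Propositional using (_∈_; find; lose)
open import Data.List.Membership.Propositional.Properties
  using (∈-downFrom⁺; ∈-downFrom⁻; ∈-map⁺; ∈-map⁻; ∈-filter⁺; ∈-filter⁻; ∈-upTo⁺)
open import Data.List.Properties using (∷-injective)
import Data.List.Relation.Unary.All as All
open import Data.List.Relation.Unary.All.Properties using (all⁺; all⁻)
open import Data.List.Relation.Unary.Any using (here; there)
open import Data.List.Relation.Unary.Any.Properties using (any⁺; any⁻)
open import Data.Nat.Base
  using (ℕ; zero; suc; pred; _+_; _*_; _∸_; _^_; _⊔_; _≤_; _<_; z≤n; s≤s; _≡ᵇ_)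
open import Data.Nat.DivMod using (_/_; _%_; m/n≡1+[m∸n]/n; m%n<n; m/n*n≤m; m<n*o⇒m/o<n)
open import Data.Nat.Properties
  using ( _≤?_; _<?_; ≤-refl; ≤-reflexive; ≤-trans; <-trans; <-irrefl; <-≤-trans; ≤-<-trans
        ; <⇒≤; ≰⇒>; ≮⇒≥; suc-injective; m≤n⇒m≤1+n; m≤n⇒m<n∨m≡n; m<1+n⇒m<n∨m≡n
        ; +-comm; +-suc; +-identityʳ; +-mono-≤; +-monoˡ-<; m≤m+n; m<m+n
        ; *-comm; *-assoc; *-distribˡ-+; *-monoˡ-≤; *-monoʳ-≤; *-cancelʳ-≤
        ; m^n>0; m^n≢0; ^-monoʳ-≤; m≤m⊔n; m≤n⊔m; ⊔-lub; m≥n⇒m⊔n≡m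
        ; pred[m∸n]≡m∸[1+n]; m∸n≤m; n∸n≡0; +-∸-assoc; m∸[m∸n]≡n; m+[n∸m]≡n
        ; module ≤-Reasoning)
open import Data.Nat.Tactic.RingSolver using (solve-∀)
open import Data.Product.Base using (∃-syntax; _×_; _,_; proj₁; proj₂)
open import Data.Sum.Base using (inj₁; inj₂)
open import Data.Vec.Base using (Vec; []; _∷_; head; tail; lookup; tabulate)
open import Data.Vec.Properties using (tabulate∘lookup)
open import Function.Base using (_∘_)
open import Function.Bundles using (Equivalence)
open import Relation.Binary.PropositionalEquality
  using (_≡_; refl; sym; trans; cong; cong₂; subst; module ≡-Reasoning)
open import Relation.Nullary.Decidable using (yes; no)

open import Defs

private
  variable
    k m : ℕ

toℕ : Bool → ℕ
toℕ false = 0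
toℕ true  = 1

toℕ-∧ : ∀ a b → toℕ (a ∧ b) ≡ toℕ a * toℕ b
toℕ-∧ false b     = refl
toℕ-∧ true  false = refl
toℕ-∧ true  true  = refl

toℕ-∨ : ∀ a b → toℕ (a ∨ b) ≡ 1 ∸ (1 ∸ toℕ a) * (1 ∸ toℕ b)
toℕ-∨ false false = refl
toℕ-∨ false true  = refl
toℕ-∨ true  b     = refl

toℕ-==ᵇ : ∀ a b → toℕ (a ==ᵇ b) ≡ toℕ a * toℕ b + (1 ∸ toℕ a) * (1 ∸ toℕ b)
toℕ-==ᵇ false false = refl
toℕ-==ᵇ false true  = refl
toℕ-==ᵇ true  false = refl
toℕ-==ᵇ true  true  = refl

toℕ-≡ᵇ1 : ∀ {n} → n < 2 → toℕ (n ≡ᵇ 1) ≡ n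
toℕ-≡ᵇ1 (s≤s z≤n)       = refl
toℕ-≡ᵇ1 (s≤s (s≤s z≤n)) = refl

==ᵇ⇒≡ : ∀ {a b} → T (a ==ᵇ b) → a ≡ b
==ᵇ⇒≡ {false} {false} _ = refl
==ᵇ⇒≡ {true}  {true}  _ = refl

≡⇒==ᵇ : ∀ {a b} → a ≡ b → T (a ==ᵇ b)
≡⇒==ᵇ {false} refl = _
≡⇒==ᵇ {true}  refl = _

anyBelow : ℕ → (ℕ → Bool) → Bool
anyBelow n p = any p (downFrom n)

allBelow : ℕ → (ℕ → Bool) → Bool
allBelow n p = all p (downFrom n)

anyBelow⁻ : ∀ n p → T (anyBelow n p) → ∃[ t ] t < n × T (p t)
anyBelow⁻ n p h with t , t∈ , pt ← find (any⁻ p (downFrom n) h) = t , ∈-downFrom⁻ t∈ , pt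

anyBelow⁺ : ∀ p {n t} → t < n → T (p t) → T (anyBelow n p)
anyBelow⁺ p t<n pt = any⁺ p (lose (∈-downFrom⁺ t<n) pt)

allBelow⁻ : ∀ n p → T (allBelow n p) → ∀ {t} → t < n → T (p t)
allBelow⁻ n p h t<n = All.lookup (all⁺ p (downFrom n) h) (∈-downFrom⁺ t<n)

allBelow⁺ : ∀ n p → (∀ {t} → t < n → T (p t)) → T (allBelow n p)
allBelow⁺ n p h = all⁻ p (All.tabulate (λ t∈ → h (∈-downFrom⁻ t∈)))

infix 4 _≈[_]_
_≈[_]_ : Real → ℕ → Real → Set
X ≈[ L ] Y = ∀ {q} → q < L → X q ≡ Y q

tailᴿ : Real → Real
tailᴿ X i = X (suc i)

≈-tail : ∀ {X Y L} → X ≈[ suc L ] Y → tailᴿ X ≈[ L ] tailᴿ Y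
≈-tail X≈Y q<L = X≈Y (s≤s q<L)

length-↾ : ∀ X L → length (X ↾ L) ≡ L
length-↾ X zero    = refl
length-↾ X (suc L) = cong suc (length-↾ (tailᴿ X) L)

↾-cong : ∀ {X Y} L → X ≈[ L ] Y → X ↾ L ≡ Y ↾ L
↾-cong zero    X≈Y = refl
↾-cong (suc L) X≈Y = cong₂ _∷_ (X≈Y (s≤s z≤n)) (↾-cong L (≈-tail X≈Y))

↾-injective : ∀ {X Y} L → X ↾ L ≡ Y ↾ L → X ≈[ L ] Y
↾-injective (suc L) eq {zero}  _         = proj₁ (∷-injective eq)
↾-injective (suc L) eq {suc q} (s≤s q<L) = ↾-injective L (proj₂ (∷-injective eq)) q<L

↾-suc : ∀ X L → X ↾ suc L ≡ X ↾ L ++ [ X L ]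
↾-suc X zero    = refl
↾-suc X (suc L) = cong (X 0 ∷_) (↾-suc (tailᴿ X) L)

∈[]-cong : ∀ {X Y} σ → X ≈[ length σ ] Y → X ∈[ σ ] → Y ∈[ σ ]
∈[]-cong σ X≈Y X∈σ = trans (sym (↾-cong (length σ) X≈Y)) X∈σ

∈[↾]⁺ : ∀ {X} Y L → X ≈[ L ] Y → X ∈[ Y ↾ L ]
∈[↾]⁺ Y L X≈Y rewrite length-↾ Y L = ↾-cong L X≈Y

∈[↾]⁻ : ∀ {X} Y L → X ∈[ Y ↾ L ] → X ≈[ L ] Y
∈[↾]⁻ Y L X∈ rewrite length-↾ Y L = ↾-injective L X∈

∈⟦⟧⁻ : ∀ {X G} → X ∈⟦ G ⟧ → ∃[ σ ] σ ∈ G × X ∈[ σ ]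
∈⟦⟧⁻ (here X∈σ) = _ , here refl , X∈σ
∈⟦⟧⁻ (there X∈G) with σ , σ∈G , X∈σ ← ∈⟦⟧⁻ X∈G = σ , there σ∈G , X∈σ

∈⟦⟧⁺ : ∀ {X G σ} → σ ∈ G → X ∈[ σ ] → X ∈⟦ G ⟧
∈⟦⟧⁺ (here refl) X∈σ = here X∈σ
∈⟦⟧⁺ (there σ∈G) X∈σ = there (∈⟦⟧⁺ σ∈G X∈σ)

∈⟦⟧-cong : ∀ {X Y G L} → (∀ {σ} → σ ∈ G → length σ ≤ L) → X ≈[ L ] Y → X ∈⟦ G ⟧ → Y ∈⟦ G ⟧
∈⟦⟧-cong short X≈Y X∈G with σ , σ∈G , X∈σ ← ∈⟦⟧⁻ X∈G =
  ∈⟦⟧⁺ σ∈G (∈[]-cong σ (λ q< → X≈Y (<-≤-trans q< (short σ∈G))) X∈σ)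

isPrefix-↾⁻ : ∀ σ X K → T (isPrefix σ (X ↾ K)) → X ∈[ σ ]
isPrefix-↾⁻ []      X K       _ = refl
isPrefix-↾⁻ (a ∷ σ) X (suc K) h with a ==ᵇ X 0 in eq
... | true = cong₂ _∷_ (sym (==ᵇ⇒≡ (subst T (sym eq) _))) (isPrefix-↾⁻ σ (tailᴿ X) K h)

isPrefix-↾⁺ : ∀ σ X {K} → length σ ≤ K → X ∈[ σ ] → T (isPrefix σ (X ↾ K))
isPrefix-↾⁺ []      X _ _ = _
isPrefix-↾⁺ (a ∷ σ) X {suc K} (s≤s |σ|≤K) X∈
  with X0≡a , X∈σ ← ∷-injective X∈
  with a ==ᵇ X 0 | ≡⇒==ᵇ {a} {X 0} (sym X0≡a)
... | true | _ = isPrefix-↾⁺ σ (tailᴿ X) |σ|≤K X∈σ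

inCylinders : List Str → ℕ → Real → Bool
inCylinders G K X = any (λ σ → isPrefix σ (X ↾ K)) G

inCylinders⁻ : ∀ G {K X} → T (inCylinders G K X) → X ∈⟦ G ⟧
inCylinders⁻ G {K} {X} h with σ , σ∈ , prefix ← find (any⁻ _ G h) =
  ∈⟦⟧⁺ σ∈ (isPrefix-↾⁻ σ X K prefix)

inCylinders⁺ : ∀ {G K X} → (∀ {σ} → σ ∈ G → length σ ≤ K) → X ∈⟦ G ⟧ → T (inCylinders G K X)
inCylinders⁺ {X = X} short X∈G with σ , σ∈ , X∈σ ← ∈⟦⟧⁻ X∈G =
  any⁺ _ (lose σ∈ (isPrefix-↾⁺ σ X (short σ∈) X∈σ))

length≤maxLen : ∀ {G σ} → σ ∈ G → length σ ≤ maxLen G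
length≤maxLen {τ ∷ G} (here refl) = m≤m⊔n (length τ) (maxLen G)
length≤maxLen {τ ∷ G} (there σ∈) = ≤-trans (length≤maxLen σ∈) (m≤n⊔m (length τ) (maxLen G))

maxLen≤ : ∀ G {L} → (∀ {σ} → σ ∈ G → length σ ≤ L) → maxLen G ≤ L
maxLen≤ []      short = z≤n
maxLen≤ (τ ∷ G) short = ⊔-lub (short (here refl)) (maxLen≤ G (short ∘ there))

maxLen-uniform : ∀ τ G {N} → (∀ {σ} → σ ∈ τ ∷ G → length σ ≡ N) → maxLen (τ ∷ G) ≡ N
maxLen-uniform τ G uniform =
  trans (cong (_⊔ maxLen G) (uniform (here refl)))
        (m≥n⇒m⊔n≡m (maxLen≤ G (≤-reflexive ∘ uniform ∘ there)))

[1+n]%2≡1∸n%2 : ∀ n → suc n % 2 ≡ 1 ∸ n % 2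
[1+n]%2≡1∸n%2 0             = refl
[1+n]%2≡1∸n%2 1             = refl
[1+n]%2≡1∸n%2 (suc (suc n)) = [1+n]%2≡1∸n%2 n

[2+n]/2≡1+n/2 : ∀ n → suc (suc n) / 2 ≡ suc (n / 2)
[2+n]/2≡1+n/2 n = m/n≡1+[m∸n]/n {suc (suc n)} (s≤s (s≤s z≤n))

[1+n]/2≡n/2+n%2 : ∀ n → suc n / 2 ≡ n / 2 + n % 2
[1+n]/2≡n/2+n%2 0             = refl
[1+n]/2≡n/2+n%2 1             = refl
[1+n]/2≡n/2+n%2 (suc (suc n)) = begin
  suc (suc (suc n)) / 2       ≡⟨ [2+n]/2≡1+n/2 (suc n) ⟩
  suc (suc n / 2)             ≡⟨ cong suc ([1+n]/2≡n/2+n%2 n) ⟩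
  suc (n / 2 + n % 2)         ≡⟨ cong (_+ n % 2) (sym ([2+n]/2≡1+n/2 n)) ⟩
  suc (suc n) / 2 + n % 2     ∎
  where open ≡-Reasoning

m+2[1+n]≡2+[m+2n] : ∀ m n → m + 2 * suc n ≡ suc (suc (m + 2 * n))
m+2[1+n]≡2+[m+2n] = solve-∀

[m+2n]%2≡m%2 : ∀ m n → (m + 2 * n) % 2 ≡ m % 2
[m+2n]%2≡m%2 m zero    = cong (_% 2) (+-identityʳ m)
[m+2n]%2≡m%2 m (suc n) = trans (cong (_% 2) (m+2[1+n]≡2+[m+2n] m n)) ([m+2n]%2≡m%2 m n)

[m+2n]/2≡m/2+n : ∀ m n → (m + 2 * n) / 2 ≡ m / 2 + n
[m+2n]/2≡m/2+n m zero    = trans (cong (_/ 2) (+-identityʳ m)) (sym (+-identityʳ (m / 2)))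
[m+2n]/2≡m/2+n m (suc n) = begin
  (m + 2 * suc n) / 2         ≡⟨ cong (_/ 2) (m+2[1+n]≡2+[m+2n] m n) ⟩
  suc (suc (m + 2 * n)) / 2   ≡⟨ [2+n]/2≡1+n/2 (m + 2 * n) ⟩
  suc ((m + 2 * n) / 2)       ≡⟨ cong suc ([m+2n]/2≡m/2+n m n) ⟩
  suc (m / 2 + n)             ≡⟨ sym (+-suc (m / 2) n) ⟩
  m / 2 + suc n               ∎
  where open ≡-Reasoning

halves : ℕ → ℕ → ℕ
halves zero    m = m
halves (suc i) m = halves i m / 2

halves-/2 : ∀ i m → halves i (m / 2) ≡ halves i m / 2
halves-/2 zero    m = refl
halves-/2 (suc i) m = cong (_/ 2) (halves-/2 i m)

toℕ-bit : ∀ m i → toℕ (bit m i) ≡ halves i m % 2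
toℕ-bit m i = trans (cong toℕ (bit≡ m i)) (toℕ-≡ᵇ1 (m%n<n (halves i m) 2))
  where
  bit≡ : ∀ m i → bit m i ≡ (halves i m % 2 ≡ᵇ 1)
  bit≡ m zero    = refl
  bit≡ m (suc i) = trans (bit≡ (m / 2) i) (cong (λ x → x % 2 ≡ᵇ 1) (halves-/2 i m))

-- Big-endian: f 0 is the most significant of the t digits.
fromDigits : (ℕ → Bool) → ℕ → ℕ
fromDigits f zero    = 0
fromDigits f (suc t) = toℕ (f t) + 2 * fromDigits f t

bit-digit₀ : ∀ b m → bit (toℕ b + 2 * m) 0 ≡ b
bit-digit₀ false m = cong (_≡ᵇ 1) ([m+2n]%2≡m%2 0 m)
bit-digit₀ true  m = cong (_≡ᵇ 1) ([m+2n]%2≡m%2 1 m)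

bit-digit-suc : ∀ b m i → bit (toℕ b + 2 * m) (suc i) ≡ bit m i
bit-digit-suc false m i = cong (λ x → bit x i) ([m+2n]/2≡m/2+n 0 m)
bit-digit-suc true  m i = cong (λ x → bit x i) ([m+2n]/2≡m/2+n 1 m)

bit-fromDigits : ∀ f {t i} → i < t → bit (fromDigits f t) i ≡ f (t ∸ suc i)
bit-fromDigits f {suc t} {zero}  _         = bit-digit₀ (f t) (fromDigits f t)
bit-fromDigits f {suc t} {suc i} (s≤s i<t) =
  trans (bit-digit-suc (f t) (fromDigits f t) i) (bit-fromDigits f i<t)

fromDigits<2^ : ∀ f t → fromDigits f t < 2 ^ t
fromDigits<2^ f zero    = s≤s z≤n
fromDigits<2^ f (suc t) = begin-strict
  toℕ (f t) + 2 * fromDigits f t   <⟨ +-monoˡ-< (2 * fromDigits f t) (toℕ<2 (f t)) ⟩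
  2 + 2 * fromDigits f t           ≡⟨ sym (*-distribˡ-+ 2 1 (fromDigits f t)) ⟩
  2 * suc (fromDigits f t)         ≤⟨ *-monoʳ-≤ 2 (fromDigits<2^ f t) ⟩
  2 * 2 ^ t                        ∎
  where
  open ≤-Reasoning
  toℕ<2 : ∀ b → toℕ b < 2
  toℕ<2 false = s≤s z≤n
  toℕ<2 true  = s≤s (s≤s z≤n)

bit-2^*-+ : ∀ k m j → bit (2 ^ k * m) (k + j) ≡ bit m j
bit-2^*-+ zero    m j = cong (λ x → bit x j) (+-identityʳ m)
bit-2^*-+ (suc k) m j = begin
  bit (2 ^ suc k * m) (suc k + j)   ≡⟨ cong (λ x → bit x (suc k + j)) (*-assoc 2 (2 ^ k) m) ⟩
  bit (2 * (2 ^ k * m)) (suc (k + j)) ≡⟨ bit-digit-suc false (2 ^ k * m) (k + j) ⟩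
  bit (2 ^ k * m) (k + j)           ≡⟨ bit-2^*-+ k m j ⟩
  bit m j                           ∎
  where open ≡-Reasoning

bit-2^*-< : ∀ m {k i} → i < k → bit (2 ^ k * m) i ≡ false
bit-2^*-< m {suc k} {i} i<k = trans (cong (λ x → bit x i) (*-assoc 2 (2 ^ k) m)) (low i i<k)
  where
  low : ∀ i → i < suc k → bit (2 * (2 ^ k * m)) i ≡ false
  low zero    _         = bit-digit₀ false (2 ^ k * m)
  low (suc i) (s≤s i<k) = trans (bit-digit-suc false (2 ^ k * m) i) (bit-2^*-< m i<k)

bit⇒2^≤ : ∀ m i → T (bit m i) → 2 ^ i ≤ m
bit⇒2^≤ (suc m) zero    _   = s≤s z≤n
bit⇒2^≤ m       (suc i) set = begin
  2 * 2 ^ i     ≤⟨ *-monoʳ-≤ 2 (bit⇒2^≤ (m / 2) i set) ⟩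
  2 * (m / 2)   ≡⟨ *-comm 2 (m / 2) ⟩
  m / 2 * 2     ≤⟨ m/n*n≤m m 2 ⟩
  m             ∎
  where open ≤-Reasoning

n<2^n : ∀ n → n < 2 ^ n
n<2^n zero    = s≤s z≤n
n<2^n (suc n) = begin-strict
  suc n           ≤⟨ n<2^n n ⟩
  2 ^ n           <⟨ m<m+n (2 ^ n) (m^n>0 2 n) ⟩
  2 ^ n + 2 ^ n   ≡⟨ cong (2 ^ n +_) (sym (+-identityʳ (2 ^ n))) ⟩
  2 * 2 ^ n       ∎
  where open ≤-Reasoning

bit⇒< : ∀ m i → T (bit m i) → i < m
bit⇒< m i set = <-≤-trans (n<2^n i) (bit⇒2^≤ m i set)

digits : ℕ → ℕ → Real
digits ℓ v p = bit v (ℓ ∸ suc p)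

suc[m∸1+n]≡m+n : ∀ {m} n → 1 ≤ m → suc (m ∸ 1 + n) ≡ m + n
suc[m∸1+n]≡m+n n (s≤s z≤n) = refl

m∸[1+n]<m : ∀ {m n} → n < m → m ∸ suc n < m
m∸[1+n]<m {suc m} {n} _ = s≤s (m∸n≤m m n)

suc[m∸[1+n]]≡m∸n : ∀ {m n} → n < m → suc (m ∸ suc n) ≡ m ∸ n
suc[m∸[1+n]]≡m∸n {m} n<m = sym (+-∸-assoc 1 n<m)

m∸[1+[m∸[1+n]]]≡n : ∀ {m n} → n < m → m ∸ suc (m ∸ suc n) ≡ n
m∸[1+[m∸[1+n]]]≡n {m} n<m = trans (cong (m ∸_) (suc[m∸[1+n]]≡m∸n n<m)) (m∸[m∸n]≡n (<⇒≤ n<m))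

digits-fromDigits : ∀ f {t} → digits t (fromDigits f t) ≈[ t ] f
digits-fromDigits f p<t = trans (bit-fromDigits f (m∸[1+n]<m p<t)) (cong f (m∸[1+[m∸[1+n]]]≡n p<t))

digits-suc : ∀ ℓ v → digits (suc ℓ) v ≈[ ℓ ] digits ℓ (v / 2)
digits-suc ℓ v q<ℓ = cong (bit v) (sym (suc[m∸[1+n]]≡m∸n q<ℓ))

strAux-digits : ∀ {ℓ f v} → ℓ ≤ f → v < 2 ^ ℓ → strAux f (2 ^ ℓ + v) ≡ digits ℓ v ↾ ℓ
strAux-digits {zero}  {zero}  _         (s≤s z≤n) = refl
strAux-digits {zero}  {suc f} _         (s≤s z≤n) = refl
strAux-digits {suc ℓ} {suc f} {v} (s≤s ℓ≤f) v<2^ℓ = begin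
  strAux (suc f) (2 ^ suc ℓ + v)
    ≡⟨ strAux-suc {f} (2≤2^[1+n]+m ℓ v) ⟩
  strAux f ((2 ^ suc ℓ + v) / 2) ++ [ bit (2 ^ suc ℓ + v) 0 ]
    ≡⟨ cong₂ (λ m b → strAux f m ++ [ b ]) halve parity ⟩
  strAux f (2 ^ ℓ + v / 2) ++ [ bit v 0 ]
    ≡⟨ cong (_++ [ bit v 0 ]) (strAux-digits ℓ≤f v/2<2^ℓ) ⟩
  digits ℓ (v / 2) ↾ ℓ ++ [ bit v 0 ]
    ≡⟨ cong₂ (λ σ b → σ ++ [ b ]) (sym (↾-cong ℓ (digits-suc ℓ v))) (cong (bit v) (sym (n∸n≡0 ℓ))) ⟩
  digits (suc ℓ) v ↾ ℓ ++ [ digits (suc ℓ) v ℓ ]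
    ≡⟨ sym (↾-suc (digits (suc ℓ) v) ℓ) ⟩
  digits (suc ℓ) v ↾ suc ℓ
    ∎
  where
  open ≡-Reasoning
  strAux-suc : ∀ {f m} → 2 ≤ m → strAux (suc f) m ≡ strAux f (m / 2) ++ [ bit m 0 ]
  strAux-suc {m = suc (suc m)} (s≤s (s≤s z≤n)) = refl
  2≤2^[1+n]+m : ∀ n m → 2 ≤ 2 ^ suc n + m
  2≤2^[1+n]+m n m = ≤-trans (*-monoʳ-≤ 2 (m^n>0 2 n)) (m≤m+n (2 ^ suc n) m)
  2^[1+ℓ]+v≡v+2*2^ℓ : 2 ^ suc ℓ + v ≡ v + 2 * 2 ^ ℓ
  2^[1+ℓ]+v≡v+2*2^ℓ = +-comm (2 ^ suc ℓ) v
  halve : (2 ^ suc ℓ + v) / 2 ≡ 2 ^ ℓ + v / 2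
  halve = trans (cong (_/ 2) 2^[1+ℓ]+v≡v+2*2^ℓ) (trans ([m+2n]/2≡m/2+n v (2 ^ ℓ)) (+-comm (v / 2) (2 ^ ℓ)))
  parity : bit (2 ^ suc ℓ + v) 0 ≡ bit v 0
  parity = cong (_≡ᵇ 1) (trans (cong (_% 2) 2^[1+ℓ]+v≡v+2*2^ℓ) ([m+2n]%2≡m%2 v (2 ^ ℓ)))
  v/2<2^ℓ : v / 2 < 2 ^ ℓ
  v/2<2^ℓ = m<n*o⇒m/o<n (subst (v <_) (*-comm 2 (2 ^ ℓ)) v<2^ℓ)

str-digits : ∀ {i ℓ v} → v < 2 ^ ℓ → suc i ≡ 2 ^ ℓ + v → str i ≡ digits ℓ v ↾ ℓ
str-digits {ℓ = ℓ} {v} v<2^ℓ eq =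
  trans (cong (λ m → strAux m m) eq)
        (strAux-digits (≤-trans (<⇒≤ (n<2^n ℓ)) (m≤m+n (2 ^ ℓ) v)) v<2^ℓ)

str-index : ∀ {ℓ v} → v < 2 ^ ℓ → str (2 ^ ℓ ∸ 1 + v) ≡ digits ℓ v ↾ ℓ
str-index {ℓ} {v} v<2^ℓ = str-digits v<2^ℓ (suc[m∸1+n]≡m+n v (m^n>0 2 ℓ))

index-split : ∀ i → ∃[ ℓ ] ∃[ v ] v < 2 ^ ℓ × ℓ ≤ i × suc i ≡ 2 ^ ℓ + v
index-split zero = 0 , 0 , s≤s z≤n , z≤n , refl
index-split (suc i) with ℓ , v , v<2^ℓ , ℓ≤i , eq ← index-split i with m≤n⇒m<n∨m≡n v<2^ℓ
... | inj₁ 1+v<2^ℓ = ℓ , suc v , 1+v<2^ℓ , m≤n⇒m≤1+n ℓ≤i , trans (cong suc eq) (sym (+-suc (2 ^ ℓ) v))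
... | inj₂ 1+v≡2^ℓ = suc ℓ , 0 , m^n>0 2 (suc ℓ) , s≤s ℓ≤i , (begin
  suc (suc i)          ≡⟨ cong suc eq ⟩
  suc (2 ^ ℓ + v)      ≡⟨ sym (+-suc (2 ^ ℓ) v) ⟩
  2 ^ ℓ + suc v        ≡⟨ cong (2 ^ ℓ +_) (trans 1+v≡2^ℓ (sym (+-identityʳ (2 ^ ℓ)))) ⟩
  2 ^ suc ℓ            ≡⟨ sym (+-identityʳ (2 ^ suc ℓ)) ⟩
  2 ^ suc ℓ + 0        ∎)
  where open ≡-Reasoning

∈-decodeSet⁻ : ∀ {m σ} → σ ∈ decodeSet m → ∃[ i ] T (bit m i) × σ ≡ str i
∈-decodeSet⁻ {m} σ∈ with i , i∈ , refl ← ∈-map⁻ str σ∈ =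
  i , Equivalence.from T-≡ (proj₂ (∈-filter⁻ (λ i → bit m i ≟ true) {xs = upTo m} i∈)) , refl

∈-decodeSet⁺ : ∀ {m i} → T (bit m i) → str i ∈ decodeSet m
∈-decodeSet⁺ {m} {i} bit-i =
  ∈-map⁺ str (∈-filter⁺ (λ i → bit m i ≟ true) (∈-upTo⁺ (bit⇒< m i bit-i))
                        (Equivalence.to T-≡ bit-i))

∈-decodeSet⇒digits : ∀ {c σ} → σ ∈ decodeSet c →
  ∃[ ℓ ] ∃[ v ] v < 2 ^ ℓ × ℓ < c × T (bit c (2 ^ ℓ ∸ 1 + v)) × σ ≡ digits ℓ v ↾ ℓ
∈-decodeSet⇒digits {c} σ∈
  with i , bit-i , refl ← ∈-decodeSet⁻ σ∈
  with ℓ , v , v<2^ℓ , ℓ≤i , eq ← index-split i =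
  ℓ , v , v<2^ℓ , ≤-<-trans ℓ≤i (bit⇒< c i bit-i) , subst (T ∘ bit c) i≡ bit-i , str-digits v<2^ℓ eq
  where
  i≡ : i ≡ 2 ^ ℓ ∸ 1 + v
  i≡ = suc-injective (trans eq (sym (suc[m∸1+n]≡m+n v (m^n>0 2 ℓ))))

length-decodeSet : ∀ {c σ} → σ ∈ decodeSet c → length σ ≤ c
length-decodeSet σ∈ with ℓ , v , _ , ℓ<c , _ , refl ← ∈-decodeSet⇒digits σ∈ =
  subst (_≤ _) (sym (length-↾ (digits ℓ v) ℓ)) (<⇒≤ ℓ<c)

-- A code of {digits N w ↾ N : w < 2^N, p w}; that string has index 2^N - 1 + w.
encodeSet : ℕ → (ℕ → Bool) → ℕ
encodeSet N p = 2 ^ (2 ^ N ∸ 1) * fromDigits (λ s → p (2 ^ N ∸ suc s)) (2 ^ N)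

module _ {N : ℕ} {p : ℕ → Bool} where
  private
    offset = 2 ^ N ∸ 1
    E = fromDigits (λ s → p (2 ^ N ∸ suc s)) (2 ^ N)

    bit-E : ∀ {w} → w < 2 ^ N → bit E w ≡ p w
    bit-E w<2^N = trans (bit-fromDigits _ w<2^N) (cong p (m∸[1+[m∸[1+n]]]≡n w<2^N))

  ∈-encodeSet⁺ : ∀ {w} → w < 2 ^ N → T (p w) → digits N w ↾ N ∈ decodeSet (encodeSet N p)
  ∈-encodeSet⁺ {w} w<2^N pw = subst (_∈ _) (str-index w<2^N) (∈-decodeSet⁺ {encodeSet N p} {offset + w} set)
    where
    set : T (bit (2 ^ offset * E) (offset + w))
    set = subst T (sym (trans (bit-2^*-+ offset E w) (bit-E w<2^N))) pw

  ∈-encodeSet⁻ : ∀ {σ} → σ ∈ decodeSet (encodeSet N p) →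
                 ∃[ w ] w < 2 ^ N × T (p w) × σ ≡ digits N w ↾ N
  ∈-encodeSet⁻ σ∈ with i , bit-i , refl ← ∈-decodeSet⁻ σ∈ with offset ≤? i
  ... | no offset≰i = ⊥-elim (subst T (bit-2^*-< E (≰⇒> offset≰i)) bit-i)
  ... | yes offset≤i =
    w , w<2^N , subst T (bit-E w<2^N) bit-w , trans (cong str (sym offset+w≡i)) (str-index w<2^N)
    where
    w = i ∸ offset
    offset+w≡i : offset + w ≡ i
    offset+w≡i = m+[n∸m]≡n offset≤i
    bit-w : T (bit E w)
    bit-w = subst T (trans (cong (bit (2 ^ offset * E)) (sym offset+w≡i)) (bit-2^*-+ offset E w)) bit-i
    w<2^N : w < 2 ^ N
    w<2^N with w <? 2 ^ N
    ... | yes w<2^N = w<2^N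
    ... | no w≮2^N = ⊥-elim (<-irrefl refl (<-≤-trans (fromDigits<2^ _ (2 ^ N))
                                              (≤-trans (^-monoʳ-≤ 2 (≮⇒≥ w≮2^N)) (bit⇒2^≤ E w bit-w))))

-- Counting measure

infixr 5 _◂_
_◂_ : Bool → Real → Real
(b ◂ X) zero    = b
(b ◂ X) (suc i) = X i

-- When Φ reads only the first N bits, this is 2^N times the measure of {X : Φ X}.
count : ℕ → (Real → Bool) → ℕ
count zero    Φ = toℕ (Φ (λ _ → false))
count (suc N) Φ = count N (λ X → Φ (false ◂ X)) + count N (λ X → Φ (true ◂ X))

count-cong : ∀ N {Φ Ψ} → (∀ X → Φ X ≡ Ψ X) → count N Φ ≡ count N Ψ
count-cong zero    Φ≗Ψ = cong toℕ (Φ≗Ψ _)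
count-cong (suc N) Φ≗Ψ = cong₂ _+_ (count-cong N (λ X → Φ≗Ψ _)) (count-cong N (λ X → Φ≗Ψ _))

count-mono : ∀ N {Φ Ψ} → (∀ X → T (Φ X) → T (Ψ X)) → count N Φ ≤ count N Ψ
count-mono zero    Φ⇒Ψ = toℕ-mono (Φ⇒Ψ _)
  where
  toℕ-mono : ∀ {a b} → (T a → T b) → toℕ a ≤ toℕ b
  toℕ-mono {false}         _   = z≤n
  toℕ-mono {true}  {true}  _   = ≤-refl
  toℕ-mono {true}  {false} a⇒b = ⊥-elim (a⇒b _)
count-mono (suc N) Φ⇒Ψ = +-mono-≤ (count-mono N (λ X → Φ⇒Ψ _)) (count-mono N (λ X → Φ⇒Ψ _))

#accepted : (Str → Bool) → List Str → ℕ
#accepted f τs = length (filter (λ τ → f τ ≟ true) τs)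

#accepted-∷ : ∀ f τ τs → #accepted f (τ ∷ τs) ≡ toℕ (f τ) + #accepted f τs
#accepted-∷ f τ τs with f τ
... | true  = refl
... | false = refl

#accepted-extensions : ∀ f τs →
  #accepted f (concatMap (λ τ → (false ∷ τ) ∷ (true ∷ τ) ∷ []) τs) ≡
  #accepted (f ∘ (false ∷_)) τs + #accepted (f ∘ (true ∷_)) τs
#accepted-extensions f []       = refl
#accepted-extensions f (τ ∷ τs) = begin
  #accepted f ((false ∷ τ) ∷ (true ∷ τ) ∷ rest)     ≡⟨ #accepted-∷ f (false ∷ τ) _ ⟩
  a₀ + #accepted f ((true ∷ τ) ∷ rest)              ≡⟨ cong (a₀ +_) (#accepted-∷ f (true ∷ τ) rest) ⟩
  a₀ + (a₁ + #accepted f rest)                      ≡⟨ cong (λ r → a₀ + (a₁ + r)) (#accepted-extensions f τs) ⟩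
  a₀ + (a₁ + (#accepted f₀ τs + #accepted f₁ τs))   ≡⟨ +-interchange a₀ a₁ _ _ ⟩
  (a₀ + #accepted f₀ τs) + (a₁ + #accepted f₁ τs)   ≡⟨ sym (cong₂ _+_ (#accepted-∷ f₀ τ τs) (#accepted-∷ f₁ τ τs)) ⟩
  #accepted f₀ (τ ∷ τs) + #accepted f₁ (τ ∷ τs)     ∎
  where
  open ≡-Reasoning
  f₀ f₁ : Str → Bool
  f₀ = f ∘ (false ∷_)
  f₁ = f ∘ (true ∷_)
  a₀ = toℕ (f₀ τ)
  a₁ = toℕ (f₁ τ)
  rest = concatMap (λ τ → (false ∷ τ) ∷ (true ∷ τ) ∷ []) τs
  +-interchange : ∀ a b c d → a + (b + (c + d)) ≡ (a + c) + (b + d)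
  +-interchange = solve-∀

count-allStrings : ∀ f L → #accepted f (allStrings L) ≡ count L (λ X → f (X ↾ L))
count-allStrings f zero    = trans (#accepted-∷ f [] []) (+-identityʳ (toℕ (f [])))
count-allStrings f (suc L) =
  trans (#accepted-extensions f (allStrings L))
        (cong₂ _+_ (count-allStrings (f ∘ (false ∷_)) L) (count-allStrings (f ∘ (true ∷_)) L))

countIn≡count : ∀ G → countIn G ≡ count (maxLen G) (inCylinders G (maxLen G))
countIn≡count G = count-allStrings (λ τ → any (λ σ → isPrefix σ τ) G) (maxLen G)

Depends : ℕ → (Real → Bool) → Set
Depends M Φ = ∀ {X Y} → X ≈[ M ] Y → Φ X ≡ Φ Y

IncreasingBelow : ℕ → (ℕ → ℕ) → Set
IncreasingBelow M h = ∀ {p} → suc p < M → h p < h (suc p)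

◂-pred : ∀ b X {a} → 0 < a → (b ◂ X) a ≡ X (pred a)
◂-pred b X (s≤s z≤n) = refl

◂-cong : ∀ b {X Y M} → X ≈[ M ] Y → b ◂ X ≈[ suc M ] b ◂ Y
◂-cong b X≈Y {zero}  _         = refl
◂-cong b X≈Y {suc q} (s≤s q<M) = X≈Y q<M

pred-mono-<′ : ∀ {a b} → 0 < a → a < b → pred a < pred b
pred-mono-<′ (s≤s z≤n) (s≤s a<b) = a<b

pred-<-suc : ∀ {a N} → 0 < a → a < suc N → pred a < N
pred-<-suc (s≤s z≤n) (s≤s a<N) = a<N

increasing-head≤ : ∀ {M h p} → IncreasingBelow M h → p < M → h 0 ≤ h p
increasing-head≤ {p = zero}  inc _    = ≤-refl
increasing-head≤ {p = suc p} inc p<M = ≤-trans (increasing-head≤ inc (<⇒≤ p<M)) (<⇒≤ (inc p<M))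

-- Coordinate 0 is not read by Φ ∘ (_∘ h): it contributes a factor 2.
count-∘-skip : ∀ N M {Φ} h → Depends M Φ → (∀ {p} → p < M → 0 < h p) →
  count N (λ X → Φ (X ∘ pred ∘ h)) * 2 ^ M ≡ count M Φ * 2 ^ N →
  count (suc N) (λ X → Φ (X ∘ h)) * 2 ^ M ≡ count M Φ * 2 ^ suc N
count-∘-skip N M {Φ} h dep pos ih = begin
  (count N (λ X → Φ ((false ◂ X) ∘ h)) + count N (λ X → Φ ((true ◂ X) ∘ h))) * 2 ^ M
    ≡⟨ cong (λ a → a * 2 ^ M) (cong₂ _+_ (count-cong N (drop false)) (count-cong N (drop true))) ⟩
  (A + A) * 2 ^ M           ≡⟨ double A (2 ^ M) ⟩
  2 * (A * 2 ^ M)           ≡⟨ cong (2 *_) ih ⟩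
  2 * (count M Φ * 2 ^ N)   ≡⟨ swap (count M Φ) (2 ^ N) ⟩
  count M Φ * 2 ^ suc N     ∎
  where
  open ≡-Reasoning
  A = count N (λ X → Φ (X ∘ pred ∘ h))
  drop : ∀ b X → Φ ((b ◂ X) ∘ h) ≡ Φ (X ∘ pred ∘ h)
  drop b X = dep (λ q<M → ◂-pred b X (pos q<M))
  double : ∀ a x → (a + a) * x ≡ 2 * (a * x)
  double = solve-∀
  swap : ∀ a x → 2 * (a * x) ≡ a * (2 * x)
  swap = solve-∀

-- Coordinate 0 is read by Φ ∘ (_∘ h) as coordinate 0 of Φ.
count-∘-take : ∀ N M {Φ} h → h 0 ≡ 0 → Depends (suc M) Φ → (∀ {p} → p < M → 0 < h (suc p)) →
  (∀ b → count N (λ X → Φ (b ◂ X ∘ pred ∘ h ∘ suc)) * 2 ^ M ≡ count M (λ X → Φ (b ◂ X)) * 2 ^ N) →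
  count (suc N) (λ X → Φ (X ∘ h)) * 2 ^ suc M ≡ count (suc M) Φ * 2 ^ suc N
count-∘-take N M {Φ} h h0≡0 dep pos ih = begin
  (count N (λ X → Φ ((false ◂ X) ∘ h)) + count N (λ X → Φ ((true ◂ X) ∘ h))) * 2 ^ suc M
    ≡⟨ cong (λ a → a * 2 ^ suc M) (cong₂ _+_ (count-cong N (shift false)) (count-cong N (shift true))) ⟩
  (left false + left true) * (2 * 2 ^ M)           ≡⟨ double (left false) (left true) (2 ^ M) ⟩
  2 * (left false * 2 ^ M + left true * 2 ^ M)     ≡⟨ cong (2 *_) (cong₂ _+_ (ih false) (ih true)) ⟩
  2 * (right false * 2 ^ N + right true * 2 ^ N)   ≡⟨ sym (double (right false) (right true) (2 ^ N)) ⟩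
  (right false + right true) * (2 * 2 ^ N)         ∎
  where
  open ≡-Reasoning
  left right : Bool → ℕ
  left b = count N (λ X → Φ (b ◂ X ∘ pred ∘ h ∘ suc))
  right b = count M (λ X → Φ (b ◂ X))
  shift : ∀ b X → Φ ((b ◂ X) ∘ h) ≡ Φ (b ◂ X ∘ pred ∘ h ∘ suc)
  shift b X = dep agree
    where
    agree : (b ◂ X) ∘ h ≈[ suc M ] b ◂ X ∘ pred ∘ h ∘ suc
    agree {zero}  _         = cong (b ◂ X) h0≡0
    agree {suc q} (s≤s q<M) = ◂-pred b X (pos q<M)
  double : ∀ a b x → (a + b) * (2 * x) ≡ 2 * (a * x + b * x)
  double = solve-∀

count-∘ : ∀ N M {Φ} h → Depends M Φ → IncreasingBelow M h → (∀ {p} → p < M → h p < N) →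
  count N (λ X → Φ (X ∘ h)) * 2 ^ M ≡ count M Φ * 2 ^ N
count-∘ zero    zero    h _   _   _     = refl
count-∘ zero    (suc M) h _   _   bound with () ← bound (s≤s z≤n)
count-∘ (suc N) zero    h dep _   _     =
  count-∘-skip N 0 h dep (λ ()) (count-∘ N 0 (pred ∘ h) dep (λ ()) (λ ()))
count-∘ (suc N) (suc M) h dep inc bound with h 0 in h0
... | suc _ = count-∘-skip N (suc M) h dep pos (count-∘ N (suc M) (pred ∘ h) dep inc′ bound′)
  where
  pos : ∀ {p} → p < suc M → 0 < h p
  pos p<M = <-≤-trans (subst (0 <_) (sym h0) (s≤s z≤n)) (increasing-head≤ inc p<M)
  inc′ : IncreasingBelow (suc M) (pred ∘ h)
  inc′ p+1<M = pred-mono-<′ (pos (<⇒≤ p+1<M)) (inc p+1<M)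
  bound′ : ∀ {p} → p < suc M → pred (h p) < N
  bound′ p<M = pred-<-suc (pos p<M) (bound p<M)
... | zero =
  count-∘-take N M h h0 dep pos (λ b → count-∘ N M (pred ∘ h ∘ suc) (dep ∘ ◂-cong b) inc′ bound′)
  where
  pos : ∀ {p} → p < M → 0 < h (suc p)
  pos p<M = ≤-<-trans z≤n (inc (s≤s p<M))
  inc′ : IncreasingBelow M (pred ∘ h ∘ suc)
  inc′ p+1<M = pred-mono-<′ (pos (<⇒≤ p+1<M)) (inc (s≤s p+1<M))
  bound′ : ∀ {p} → p < M → pred (h (suc p)) < N
  bound′ p<M = pred-<-suc (pos p<M) (bound (s≤s p<M))

μ-preimage : ∀ {G H n N} h → IncreasingBelow (maxLen G) h → (∀ {p} → p < maxLen G → h p < N) →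
  (∀ {σ} → σ ∈ H → length σ ≡ N) → (∀ {X} → X ∈⟦ H ⟧ → (X ∘ h) ∈⟦ G ⟧) →
  μ[ G ]≤2^- n → μ[ H ]≤2^- n
μ-preimage {H = []} h inc bound uniform H⊆h⁻¹G μG = z≤n
μ-preimage {G} {H@(τ ∷ H′)} {n} {N} h inc bound uniform H⊆h⁻¹G μG = begin
  countIn H * 2 ^ n                   ≡⟨ cong (_* 2 ^ n) countIn-H ⟩
  count N (inCylinders H N) * 2 ^ n   ≤⟨ *-cancelʳ-≤ _ _ (2 ^ M) {{m^n≢0 2 M}} scaled ⟩
  2 ^ N                               ≡⟨ cong (2 ^_) (sym |H|≡N) ⟩
  2 ^ maxLen H                        ∎
  where
  open ≤-Reasoning
  M = maxLen G
  Φ = inCylinders G M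
  |H|≡N : maxLen H ≡ N
  |H|≡N = maxLen-uniform τ H′ uniform
  countIn-H : countIn H ≡ count N (inCylinders H N)
  countIn-H = trans (countIn≡count H) (cong (λ L → count L (inCylinders H L)) |H|≡N)
  dep : Depends M Φ
  dep X≈Y = cong (λ τ → any (λ σ → isPrefix σ τ) G) (↾-cong M X≈Y)
  preimage : ∀ X → T (inCylinders H N X) → T (Φ (X ∘ h))
  preimage X X∈H = inCylinders⁺ length≤maxLen (H⊆h⁻¹G (inCylinders⁻ H X∈H))
  reorder : ∀ a x y → a * x * y ≡ a * y * x
  reorder = solve-∀
  scaled : count N (inCylinders H N) * 2 ^ n * 2 ^ M ≤ 2 ^ N * 2 ^ M
  scaled = begin
    count N (inCylinders H N) * 2 ^ n * 2 ^ M   ≤⟨ *-monoˡ-≤ (2 ^ M) (*-monoˡ-≤ (2 ^ n) (count-mono N preimage)) ⟩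
    count N (λ X → Φ (X ∘ h)) * 2 ^ n * 2 ^ M   ≡⟨ reorder (count N (λ X → Φ (X ∘ h))) (2 ^ n) (2 ^ M) ⟩
    count N (λ X → Φ (X ∘ h)) * 2 ^ M * 2 ^ n   ≡⟨ cong (_* 2 ^ n) (count-∘ N M h dep inc bound) ⟩
    count M Φ * 2 ^ N * 2 ^ n                   ≡⟨ cong (λ a → a * 2 ^ N * 2 ^ n) (sym (countIn≡count G)) ⟩
    countIn G * 2 ^ N * 2 ^ n                   ≡⟨ reorder (countIn G) (2 ^ N) (2 ^ n) ⟩
    countIn G * 2 ^ n * 2 ^ N                   ≤⟨ *-monoˡ-≤ (2 ^ N) μG ⟩
    2 ^ M * 2 ^ N                               ≡⟨ *-comm (2 ^ M) (2 ^ N) ⟩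
    2 ^ N * 2 ^ M                               ∎

-- Primitive recursive functions

record IsPR (k : ℕ) (f : Vec ℕ k → ℕ) : Set where
  constructor isPR
  field
    term    : PR k
    correct : ∀ xs → ⟦ term ⟧ xs ≡ f xs

record IsPR* (k m : ℕ) (F : Vec ℕ k → Vec ℕ m) : Set where
  constructor isPR*
  field
    terms    : Vec (PR k) m
    correct* : ∀ xs → ⟦ terms ⟧* xs ≡ F xs

IsPR-cong : ∀ {f h} → IsPR k f → (∀ xs → f xs ≡ h xs) → IsPR k h
IsPR-cong (isPR t ok) f≗h = isPR t (λ xs → trans (ok xs) (f≗h xs))

IsPR*-cong : ∀ {F G} → IsPR* k m F → (∀ xs → F xs ≡ G xs) → IsPR* k m G
IsPR*-cong (isPR* ts ok) F≗G = isPR* ts (λ xs → trans (ok xs) (F≗G xs))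

var : (i : Fin k) → IsPR k (λ xs → lookup xs i)
var i = isPR (P i) (λ _ → refl)

[]ᴾ : IsPR* k 0 (λ _ → [])
[]ᴾ = isPR* [] (λ _ → refl)

infixr 5 _∷ᴾ_
_∷ᴾ_ : ∀ {f F} → IsPR k f → IsPR* k m F → IsPR* k (suc m) (λ xs → f xs ∷ F xs)
isPR t ok ∷ᴾ isPR* ts oks = isPR* (t ∷ ts) (λ xs → cong₂ _∷_ (ok xs) (oks xs))

infixr 9 _∘ᴾ_
_∘ᴾ_ : ∀ {f F} → IsPR m f → IsPR* k m F → IsPR k (λ xs → f (F xs))
_∘ᴾ_ {F = F} (isPR t ok) (isPR* ts oks) =
  isPR (C t ts) (λ xs → trans (cong ⟦ t ⟧ (oks xs)) (ok (F xs)))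

recᴾ : ∀ {f h} → IsPR k f → IsPR (suc (suc k)) h → (F : ℕ → Vec ℕ k → ℕ) →
       (∀ xs → F 0 xs ≡ f xs) → (∀ n xs → F (suc n) xs ≡ h (n ∷ F n xs ∷ xs)) →
       IsPR (suc k) (λ v → F (head v) (tail v))
recᴾ (isPR tf okf) (isPR th okh) F base step = isPR (R tf th) correct
  where
  correct : ∀ v → ⟦ R tf th ⟧ v ≡ F (head v) (tail v)
  correct (zero  ∷ xs) = trans (okf xs) (sym (base xs))
  correct (suc n ∷ xs) =
    trans (cong (λ r → ⟦ th ⟧ (n ∷ r ∷ xs)) (correct (n ∷ xs))) (trans (okh _) (sym (step n xs)))

renameᴾ : ∀ {n} (ρ : Fin m → Fin n) → IsPR* n m (λ xs → tabulate (λ i → lookup xs (ρ i)))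
renameᴾ {zero}  ρ = []ᴾ
renameᴾ {suc m} ρ = var (ρ Fin.zero) ∷ᴾ renameᴾ (λ i → ρ (Fin.suc i))

idᴾ : IsPR* k k (λ xs → xs)
idᴾ = IsPR*-cong (renameᴾ (λ i → i)) tabulate∘lookup

tailᴾ : IsPR* (suc k) k tail
tailᴾ = IsPR*-cong (renameᴾ Fin.suc) (λ where (_ ∷ xs) → tabulate∘lookup xs)

dropSecondᴾ : IsPR* (suc (suc k)) (suc k) (λ v → head v ∷ tail (tail v))
dropSecondᴾ = IsPR*-cong (renameᴾ ρ) (λ where (x ∷ _ ∷ xs) → cong (x ∷_) (tabulate∘lookup xs))
  where
  ρ : Fin (suc k) → Fin (suc (suc k))
  ρ Fin.zero    = Fin.zero
  ρ (Fin.suc i) = Fin.suc (Fin.suc i)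

weaken : ∀ {f} → IsPR k f → IsPR (suc k) (λ v → f (tail v))
weaken f = f ∘ᴾ tailᴾ

letᴾ : ∀ {f a} → IsPR (suc k) f → IsPR k a → IsPR k (λ xs → f (a xs ∷ xs))
letᴾ f a = f ∘ᴾ (a ∷ᴾ idᴾ)

ap₁ : ∀ {φ f} → IsPR 1 φ → IsPR k f → IsPR k (λ xs → φ (f xs ∷ []))
ap₁ φ f = φ ∘ᴾ (f ∷ᴾ []ᴾ)

ap₂ : ∀ {φ f h} → IsPR 2 φ → IsPR k f → IsPR k h → IsPR k (λ xs → φ (f xs ∷ h xs ∷ []))
ap₂ φ f h = φ ∘ᴾ (f ∷ᴾ h ∷ᴾ []ᴾ)

sucᴾ : ∀ {f} → IsPR k f → IsPR k (λ xs → suc (f xs))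
sucᴾ = ap₁ successor
  where
  successor : IsPR 1 (λ v → suc (head v))
  successor = isPR S (λ where (_ ∷ []) → refl)

constᴾ : ∀ n → IsPR k (λ _ → n)
constᴾ zero    = zero₀ ∘ᴾ []ᴾ
  where
  zero₀ : IsPR 0 (λ _ → 0)
  zero₀ = isPR Z (λ where [] → refl)
constᴾ (suc n) = sucᴾ (constᴾ n)

PrimRec⇒IsPR : ∀ {g} → PrimRec g → IsPR 1 (λ v → g (head v))
PrimRec⇒IsPR (t , ok) = isPR t (λ where (n ∷ []) → ok n)

apᴾ : ∀ {g f} → PrimRec g → IsPR k f → IsPR k (λ xs → g (f xs))
apᴾ g = ap₁ (PrimRec⇒IsPR g)

IsPR⇒PrimRec : ∀ {f} → IsPR 1 f → PrimRec (λ n → f (n ∷ []))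
IsPR⇒PrimRec (isPR t ok) = t , λ n → ok (n ∷ [])

infixl 6 _+ᴾ_ _∸ᴾ_
infixl 7 _*ᴾ_

_+ᴾ_ : ∀ {f h} → IsPR k f → IsPR k h → IsPR k (λ xs → f xs + h xs)
_+ᴾ_ = ap₂ add
  where
  add : IsPR 2 (λ v → head v + head (tail v))
  add = recᴾ (var (# 0)) (sucᴾ (var (# 1))) (λ n xs → n + head xs)
             (λ where (_ ∷ []) → refl) (λ _ _ → refl)

_*ᴾ_ : ∀ {f h} → IsPR k f → IsPR k h → IsPR k (λ xs → f xs * h xs)
_*ᴾ_ = ap₂ mul
  where
  mul : IsPR 2 (λ v → head v * head (tail v))
  mul = recᴾ (constᴾ 0) (var (# 2) +ᴾ var (# 1)) (λ n xs → n * head xs)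
             (λ _ → refl) (λ where _ (_ ∷ []) → refl)

_∸ᴾ_ : ∀ {f h} → IsPR k f → IsPR k h → IsPR k (λ xs → f xs ∸ h xs)
f ∸ᴾ h = ap₂ monus h f
  where
  predᴾ : IsPR 1 (λ v → pred (head v))
  predᴾ = recᴾ (constᴾ 0) (var (# 0)) (λ n _ → pred n) (λ where [] → refl) (λ _ _ → refl)

  monus : IsPR 2 (λ v → head (tail v) ∸ head v)
  monus = recᴾ (var (# 0)) (ap₁ predᴾ (var (# 1))) (λ n xs → head xs ∸ n)
               (λ where (_ ∷ []) → refl) (λ where n (x ∷ []) → sym (pred[m∸n]≡m∸[1+n] x n))

2^ᴾ_ : ∀ {f} → IsPR k f → IsPR k (λ xs → 2 ^ f xs)
2^ᴾ_ = ap₁ pow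
  where
  pow : IsPR 1 (λ v → 2 ^ head v)
  pow = recᴾ (constᴾ 1) (constᴾ 2 *ᴾ var (# 1)) (λ n _ → 2 ^ n) (λ where [] → refl) (λ _ _ → refl)

%2ᴾ : ∀ {f} → IsPR k f → IsPR k (λ xs → f xs % 2)
%2ᴾ = ap₁ mod2
  where
  mod2 : IsPR 1 (λ v → head v % 2)
  mod2 = recᴾ (constᴾ 0) (constᴾ 1 ∸ᴾ var (# 1)) (λ n _ → n % 2)
              (λ where [] → refl) (λ n _ → [1+n]%2≡1∸n%2 n)

/2ᴾ : ∀ {f} → IsPR k f → IsPR k (λ xs → f xs / 2)
/2ᴾ = ap₁ div2
  where
  div2 : IsPR 1 (λ v → head v / 2)
  div2 = recᴾ (constᴾ 0) (var (# 1) +ᴾ %2ᴾ (var (# 0))) (λ n _ → n / 2)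
              (λ where [] → refl) (λ n _ → [1+n]/2≡n/2+n%2 n)

record IsPRPred (k : ℕ) (p : Vec ℕ k → Bool) : Set where
  constructor isPRPred
  field
    characteristic : IsPR k (λ xs → toℕ (p xs))

bitᴾ : ∀ {f i} → IsPR k f → IsPR k i → IsPRPred k (λ xs → bit (f xs) (i xs))
bitᴾ {f = f} {i} χf χi =
  isPRPred (IsPR-cong (%2ᴾ (ap₂ halvesᴾ χi χf)) (λ xs → sym (toℕ-bit (f xs) (i xs))))
  where
  halvesᴾ : IsPR 2 (λ v → halves (head v) (head (tail v)))
  halvesᴾ = recᴾ (var (# 0)) (/2ᴾ (var (# 1))) (λ i xs → halves i (head xs))
                 (λ where (_ ∷ []) → refl) (λ _ _ → refl)

infixr 6 _∧ᴾ_
infix  7 _==ᴾ_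

_∧ᴾ_ : ∀ {p q} → IsPRPred k p → IsPRPred k q → IsPRPred k (λ xs → p xs ∧ q xs)
_∧ᴾ_ {p = p} {q} (isPRPred χp) (isPRPred χq) =
  isPRPred (IsPR-cong (χp *ᴾ χq) (λ xs → sym (toℕ-∧ (p xs) (q xs))))

_==ᴾ_ : ∀ {p q} → IsPRPred k p → IsPRPred k q → IsPRPred k (λ xs → p xs ==ᵇ q xs)
_==ᴾ_ {p = p} {q} (isPRPred χp) (isPRPred χq) =
  isPRPred (IsPR-cong (χp *ᴾ χq +ᴾ (constᴾ 1 ∸ᴾ χp) *ᴾ (constᴾ 1 ∸ᴾ χq))
                      (λ xs → sym (toℕ-==ᵇ (p xs) (q xs))))

substᴾ : ∀ {p a} → IsPRPred (suc k) p → IsPR (suc k) a → IsPRPred (suc k) (λ v → p (a v ∷ tail v))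
substᴾ (isPRPred p) a = isPRPred (p ∘ᴾ (a ∷ᴾ tailᴾ))

anyBelowᴾ : ∀ {n p} → IsPR k n → IsPRPred (suc k) p →
            IsPRPred k (λ xs → anyBelow (n xs) (λ t → p (t ∷ xs)))
anyBelowᴾ {p = p} n (isPRPred χ) = isPRPred (letᴾ search n)
  where
  search : IsPR (suc _) (λ v → toℕ (anyBelow (head v) (λ t → p (t ∷ tail v))))
  search = recᴾ (constᴾ 0) (constᴾ 1 ∸ᴾ (constᴾ 1 ∸ᴾ χ ∘ᴾ dropSecondᴾ) *ᴾ (constᴾ 1 ∸ᴾ var (# 1)))
                (λ n xs → toℕ (anyBelow n (λ t → p (t ∷ xs)))) (λ _ → refl)
                (λ n xs → toℕ-∨ (p (n ∷ xs)) (anyBelow n (λ t → p (t ∷ xs))))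

allBelowᴾ : ∀ {n p} → IsPR k n → IsPRPred (suc k) p →
            IsPRPred k (λ xs → allBelow (n xs) (λ t → p (t ∷ xs)))
allBelowᴾ {p = p} n (isPRPred χ) = isPRPred (letᴾ search n)
  where
  search : IsPR (suc _) (λ v → toℕ (allBelow (head v) (λ t → p (t ∷ tail v))))
  search = recᴾ (constᴾ 1) (χ ∘ᴾ dropSecondᴾ *ᴾ var (# 1))
                (λ n xs → toℕ (allBelow n (λ t → p (t ∷ xs)))) (λ _ → refl)
                (λ n xs → toℕ-∧ (p (n ∷ xs)) (allBelow n (λ t → p (t ∷ xs))))

fromDigitsᴾ : ∀ {n p} → IsPR k n → IsPRPred (suc k) p →
              IsPR k (λ xs → fromDigits (λ t → p (t ∷ xs)) (n xs))
fromDigitsᴾ {p = p} n (isPRPred χ) = letᴾ value n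
  where
  value : IsPR (suc _) (λ v → fromDigits (λ t → p (t ∷ tail v)) (head v))
  value = recᴾ (constᴾ 0) (χ ∘ᴾ dropSecondᴾ +ᴾ constᴾ 2 *ᴾ var (# 1))
               (λ n xs → fromDigits (λ t → p (t ∷ xs)) n) (λ _ → refl) (λ _ _ → refl)

encodeSetᴾ : ∀ {N p} → IsPR k N → IsPRPred (suc k) p →
             IsPR k (λ xs → encodeSet (N xs) (λ w → p (w ∷ xs)))
encodeSetᴾ N p =
  2^ᴾ (2^ᴾ N ∸ᴾ constᴾ 1) *ᴾ fromDigitsᴾ (2^ᴾ N) (substᴾ p (2^ᴾ weaken N ∸ᴾ sucᴾ (var (# 0))))

-- The preimage test

-- (digits N w) ∘ g ∈ [decodeSet c], decided by a bounded search over the strings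
-- digits ℓ v ↾ ℓ (of index 2^ℓ - 1 + v) with ℓ < c.
selectsVia : (ℕ → ℕ) → ℕ → ℕ → ℕ → ℕ → ℕ → Bool
selectsVia g c N w ℓ v = bit c (2 ^ ℓ ∸ 1 + v) ∧ allBelow ℓ λ p → digits ℓ v p ==ᵇ digits N w (g p)

selects : (ℕ → ℕ) → ℕ → ℕ → ℕ → Bool
selects g c N w = anyBelow c λ ℓ → anyBelow (2 ^ ℓ) (selectsVia g c N w ℓ)

selects⁻ : ∀ {g c N w} → T (selects g c N w) → (digits N w ∘ g) ∈⟦ decodeSet c ⟧
selects⁻ {g} {c} {N} {w} sel
  with ℓ , _ , sel-ℓ ← anyBelow⁻ c (λ ℓ → anyBelow (2 ^ ℓ) (selectsVia g c N w ℓ)) sel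
  with v , v<2^ℓ , sel-v ← anyBelow⁻ (2 ^ ℓ) (selectsVia g c N w ℓ) sel-ℓ
  with bit-c , agree ← Equivalence.to T-∧ sel-v =
  ∈⟦⟧⁺ (subst (_∈ decodeSet c) (str-index {ℓ} v<2^ℓ) (∈-decodeSet⁺ {c} {2 ^ ℓ ∸ 1 + v} bit-c))
       (∈[↾]⁺ (digits ℓ v) ℓ (λ p<ℓ → sym (==ᵇ⇒≡ (allBelow⁻ ℓ _ agree p<ℓ))))

selects⁺ : ∀ {g c N w} → (digits N w ∘ g) ∈⟦ decodeSet c ⟧ → T (selects g c N w)
selects⁺ {g} {c} {N} {w} Y∈
  with σ , σ∈ , Y∈σ ← ∈⟦⟧⁻ Y∈
  with ℓ , v , v<2^ℓ , ℓ<c , bit-c , refl ← ∈-decodeSet⇒digits σ∈ =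
  anyBelow⁺ (λ ℓ → anyBelow (2 ^ ℓ) (selectsVia g c N w ℓ)) ℓ<c
    (anyBelow⁺ (selectsVia g c N w ℓ) v<2^ℓ (Equivalence.from T-∧ (bit-c ,
      allBelow⁺ ℓ _ (λ p<ℓ → ≡⇒==ᵇ (sym (∈[↾]⁻ (digits ℓ v) ℓ Y∈σ p<ℓ))))))

-- The preimage of [decodeSet c] under X ↦ X ∘ g, as a set of strings of length g c.
preimageCode : (ℕ → ℕ) → ℕ → ℕ
preimageCode g c = encodeSet (g c) (selects g c (g c))

module _ {g : ℕ → ℕ} (g-inc : StrictlyIncreasing g) {c : ℕ} where
  private
    N = g c

    g-mono-< : ∀ {p q} → p < q → g p < g q
    g-mono-< {p} {suc q} p<q with m<1+n⇒m<n∨m≡n p<q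
    ... | inj₁ p<q′ = <-trans (g-mono-< p<q′) (g-inc q)
    ... | inj₂ refl = g-inc p

  ∈-preimage⁺ : ∀ {X} → (X ∘ g) ∈⟦ decodeSet c ⟧ → X ∈⟦ decodeSet (preimageCode g c) ⟧
  ∈-preimage⁺ {X} Xg∈ =
    ∈⟦⟧⁺ (∈-encodeSet⁺ {N = N} {p = selects g c N} (fromDigits<2^ X N) selected) X∈τ
    where
    w = fromDigits X N
    selected : T (selects g c N w)
    selected = selects⁺ {g} {c} {N} {w} (∈⟦⟧-cong length-decodeSet Xg≈ Xg∈)
      where
      Xg≈ : X ∘ g ≈[ c ] digits N w ∘ g
      Xg≈ p<c = sym (digits-fromDigits X (g-mono-< p<c))
    X∈τ : X ∈[ digits N w ↾ N ]
    X∈τ = ∈[↾]⁺ (digits N w) N (λ q<N → sym (digits-fromDigits X q<N))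

  ∈-preimage⁻ : ∀ {X} → X ∈⟦ decodeSet (preimageCode g c) ⟧ → (X ∘ g) ∈⟦ decodeSet c ⟧
  ∈-preimage⁻ X∈
    with σ , σ∈ , X∈σ ← ∈⟦⟧⁻ X∈
    with w , _ , sel , refl ← ∈-encodeSet⁻ {N = N} {p = selects g c N} σ∈ =
    ∈⟦⟧-cong length-decodeSet (λ p<c → sym (∈[↾]⁻ (digits N w) N X∈σ (g-mono-< p<c)))
              (selects⁻ {g} {c} {N} {w} sel)

  length-preimage : ∀ {σ} → σ ∈ decodeSet (preimageCode g c) → length σ ≡ N
  length-preimage σ∈ with w , _ , _ , refl ← ∈-encodeSet⁻ {N = N} {p = selects g c N} σ∈ =
    length-↾ (digits N w) N

  μ-preimageCode : ∀ {n} → μ[ decodeSet c ]≤2^- n → μ[ decodeSet (preimageCode g c) ]≤2^- n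
  μ-preimageCode {n} = μ-preimage {n = n} g (λ _ → g-inc _) bound length-preimage ∈-preimage⁻
    where
    bound : ∀ {p} → p < maxLen (decodeSet c) → g p < N
    bound p<M = g-mono-< (<-≤-trans p<M (maxLen≤ _ length-decodeSet))

selectsᴾ : ∀ {g c N w} → PrimRec g → IsPR k c → IsPR k N → IsPR k w →
           IsPRPred k (λ xs → selects g (c xs) (N xs) (w xs))
selectsᴾ g c N w =
  anyBelowᴾ c (anyBelowᴾ (2^ᴾ var (# 0))
    (bitᴾ (weaken (weaken c)) (2^ᴾ var (# 1) ∸ᴾ constᴾ 1 +ᴾ var (# 0)) ∧ᴾ
     allBelowᴾ (var (# 1))
       (bitᴾ (var (# 1)) (var (# 2) ∸ᴾ sucᴾ (var (# 0))) ==ᴾ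
        bitᴾ (weaken (weaken (weaken w))) (weaken (weaken (weaken N)) ∸ᴾ sucᴾ (apᴾ g (var (# 0)))))))

preimageCodeᴾ : ∀ {g c} → PrimRec g → IsPR k c → IsPR k (λ xs → preimageCode g (c xs))
preimageCodeᴾ g c = encodeSetᴾ (apᴾ g c) (selectsᴾ g (weaken c) (weaken (apᴾ g c)) (var (# 0)))

preimageTest : (g : ℕ → ℕ) → PrimRec g → StrictlyIncreasing g → PRTest → PRTest
preimageTest g gᴾ g-inc T = record
  { code   = λ n → preimageCode g (code n)
  ; codePR = IsPR⇒PrimRec (preimageCodeᴾ gᴾ (apᴾ codePR (var (# 0))))
  ; small  = λ n → μ-preimageCode g-inc {n = n} (small n)
  }
  where open PRTest T

theorem2p8 : (X : Real) → BPRandom X → (g : ℕ → ℕ) → PrimRec g → StrictlyIncreasing g →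
    BPRandom (λ i → X (g i))
theorem2p8 X X-random g gᴾ g-inc T with n , X∉ ← X-random (preimageTest g gᴾ g-inc T) =
  n , X∉ ∘ ∈-preimage⁺ g-inc
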